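{- Let $q>3$ be an integer. Then for no integer $m>0$, constant $C\in\mathbb C$ and polynomial $Q(x)\in\mathbb C[x]$ does the identity $$(1-x)^m=C+Q(x)\cdot\frac{1-x^q}{1-x}$$ hold. -}

module Defs where

open import Level using (Level; _⊔_) renaming (suc to lsuc)
open import Algebra.Bundles using (CommutativeRing)
open import Data.Nat using (ℕ; zero; suc)
open import Data.List using (List; []; _∷_; replicate)
open import Data.Product using (Σ; _×_)
open import Relation.Nullary using (¬_)
open import Relation.Binary.PropositionalEquality using (_≡_)

ringFromℕ : ∀ {c ℓ} (R : CommutativeRing c ℓ) → ℕ → CommutativeRing.Carrier R
ringFromℕ R zero    = CommutativeRing.0# R
ringFromℕ R (suc n) = CommutativeRing._+_ R (CommutativeRing.1# R) (ringFromℕ R n)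

record CharZeroField (c ℓ : Level) : Set (lsuc (c ⊔ ℓ)) where
  field
    commRing : CommutativeRing c ℓ
  open CommutativeRing commRing public
  field
    1≉0     : ¬ (1# ≈ 0#)
    inverse : ∀ x → ¬ (x ≈ 0#) → Σ Carrier (λ y → (x * y) ≈ 1#)
    charZero : ∀ n → ringFromℕ commRing n ≈ 0# → n ≡ 0

-- Univariate polynomials over the field, as coefficient lists
-- (lowest degree first); equality is coefficientwise.
module Poly {c ℓ} (F : CharZeroField c ℓ) where
  open CharZeroField F

  Pol : Set c
  Pol = List Carrier

  coeff : Pol → ℕ → Carrier
  coeff []       _       = 0#
  coeff (a ∷ p)  zero    = a
  coeff (a ∷ p)  (suc k) = coeff p k

  _≈P_ : Pol → Pol → Set ℓ
  p ≈P q = ∀ k → coeff p k ≈ coeff q k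

  infixl 6 _+P_
  infixl 7 _*P_ _·P_

  _+P_ : Pol → Pol → Pol
  []      +P q       = q
  p       +P []      = p
  (a ∷ p) +P (b ∷ q) = (a + b) ∷ (p +P q)

  _·P_ : Carrier → Pol → Pol
  a ·P []      = []
  a ·P (b ∷ q) = (a * b) ∷ (a ·P q)

  _*P_ : Pol → Pol → Pol
  []      *P q = []
  (a ∷ p) *P q = (a ·P q) +P (0# ∷ (p *P q))

  const : Carrier → Pol
  const a = a ∷ []

  oneP : Pol
  oneP = const 1#

  _^P_ : Pol → ℕ → Pol
  p ^P zero  = oneP
  p ^P suc n = p *P (p ^P n)

  oneMinusX : Pol
  oneMinusX = 1# ∷ (- 1#) ∷ []

  -- (1 - x^q)/(1 - x) = 1 + x + ... + x^(q-1)
  geomSum : ℕ → Pol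
  geomSum q = replicate q 1#

module Submission where

-- Reduce the identity modulo x^q − 1 and multiply it by 1 − x: Q·(1 − x^q) vanishes, so the
-- coefficient vector of (1 − x)^(m+1) mod x^q − 1, an integer vector, equals C times that of
-- 1 − x. Characteristic zero then makes C an integer c, and in ℤ^q we get Δ^(m+1) δ = c · Δ δ,
-- where Δ = 1 − (cyclic shift) and δ is the first unit vector.
-- The energies E k = ‖Δ^k δ‖² are log-convex: Cauchy–Schwarz applied to ‖Δv‖² = ⟨shift v, −Δ²v⟩.
-- Hence E (k+1) / E k never decreases. For q ≥ 4 the first values are E 1, E 2, E 3 = 2, 6, 20,
-- so the ratio is at least 10/3 from k = 2 on, whereas proportionality forces
-- E (m+2) / E (m+1) = E 2 / E 1 = 3.

open import Defs

module CyclicVectors where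

  open import Data.Nat as ℕ using (ℕ; zero; suc)
  import Data.Nat.Properties as ℕP
  open import Data.Integer as ℤ
    using (ℤ; +_; -[1+_]; _+_; _*_; -_; _-_; _≤_; _<_; 0ℤ; 1ℤ; -1ℤ; Positive; NonNegative; +≤+; +<+)
  open import Data.Integer.Properties
  open import Data.Integer.Tactic.RingSolver using (solve-∀)
  open import Algebra.Properties.Semiring.Sum +-*-semiring
    using (sum; sum-cong-≗; sum-init-last; ∑-distrib-+; *-distribˡ-sum; sum-replicate-zero)
  open import Data.Fin using (Fin; zero; suc; fromℕ; inject₁)
  open import Data.Vec.Functional using (Vector)
  open import Data.Product using (_×_; _,_; proj₁; proj₂; uncurry)
  open import Function using (_∘_)
  open import Relation.Binary.PropositionalEquality
  open import Relation.Nullary using (¬_)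

  sum-neg : ∀ {n} (g : Vector ℤ n) → sum (λ i → - g i) ≡ - sum g
  sum-neg g = begin
    sum (λ i → - g i)       ≡⟨ sum-cong-≗ (sym ∘ -1*i≡-i ∘ g) ⟩
    sum (λ i → -1ℤ * g i)   ≡⟨ *-distribˡ-sum -1ℤ g ⟨
    -1ℤ * sum g             ≡⟨ -1*i≡-i (sum g) ⟩
    - sum g                 ∎
    where open ≡-Reasoning

  sum-nonNeg : ∀ {n} (g : Vector ℤ n) → (∀ i → 0ℤ ≤ g i) → 0ℤ ≤ sum g
  sum-nonNeg {zero}  g g≥0 = ≤-refl
  sum-nonNeg {suc n} g g≥0 = +-mono-≤ (g≥0 zero) (sum-nonNeg (g ∘ suc) (g≥0 ∘ suc))

  ⟨_,_⟩ : ∀ {n} → Vector ℤ n → Vector ℤ n → ℤ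
  ⟨ a , b ⟩ = sum (λ i → a i * b i)

  ‖_‖² : ∀ {n} → Vector ℤ n → ℤ
  ‖ a ‖² = ⟨ a , a ⟩

  ‖‖²-nonNeg : ∀ {n} (a : Vector ℤ n) → 0ℤ ≤ ‖ a ‖²
  ‖‖²-nonNeg a = sum-nonNeg (λ i → a i * a i) (λ i → x*x≥0 (a i))
    where
    x*x≥0 : ∀ x → 0ℤ ≤ x * x
    x*x≥0 (+ n)    = subst (0ℤ ≤_) (sym (+◃n≡+n (n ℕ.* n))) (+≤+ ℕ.z≤n)
    x*x≥0 -[1+ n ] = subst (0ℤ ≤_) (sym (+◃n≡+n (suc n ℕ.* suc n))) (+≤+ ℕ.z≤n)

  ‖‖²-cong : ∀ {n} {a b : Vector ℤ n} → (∀ i → a i ≡ b i) → ‖ a ‖² ≡ ‖ b ‖²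
  ‖‖²-cong a≗b = sum-cong-≗ (λ i → cong₂ _*_ (a≗b i) (a≗b i))

  ‖‖²-scale : ∀ {n} c (a : Vector ℤ n) → ‖ (λ i → c * a i) ‖² ≡ (c * c) * ‖ a ‖²
  ‖‖²-scale c a =
    trans (sum-cong-≗ (λ i → square-scale c (a i))) (sym (*-distribˡ-sum (c * c) (λ i → a i * a i)))
    where
    square-scale : ∀ c x → (c * x) * (c * x) ≡ (c * c) * (x * x)
    square-scale = solve-∀

  ‖‖²-expand : ∀ {n} x y (a b : Vector ℤ n) →
    ‖ (λ i → x * a i + y * b i) ‖² ≡ (x * x) * ‖ a ‖² + ((+ 2) * x * y) * ⟨ a , b ⟩ + (y * y) * ‖ b ‖²
  ‖‖²-expand {n} x y a b = begin
    ‖ (λ i → x * a i + y * b i) ‖²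
      ≡⟨ sum-cong-≗ (λ i → square-expand x y (a i) (b i)) ⟩
    sum (λ i → (x² * aa i + 2xy * ab i) + y² * bb i)
      ≡⟨ ∑-distrib-+ (λ i → x² * aa i + 2xy * ab i) (λ i → y² * bb i) ⟩
    sum (λ i → x² * aa i + 2xy * ab i) + sum (λ i → y² * bb i)
      ≡⟨ cong (_+ sum (λ i → y² * bb i)) (∑-distrib-+ (λ i → x² * aa i) (λ i → 2xy * ab i)) ⟩
    sum (λ i → x² * aa i) + sum (λ i → 2xy * ab i) + sum (λ i → y² * bb i)
      ≡⟨ cong₂ _+_ (cong₂ _+_ (*-distribˡ-sum x² aa) (*-distribˡ-sum 2xy ab)) (*-distribˡ-sum y² bb) ⟨
    x² * ‖ a ‖² + 2xy * ⟨ a , b ⟩ + y² * ‖ b ‖² ∎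
    where
    open ≡-Reasoning
    x² y² 2xy : ℤ
    x² = x * x
    y² = y * y
    2xy = (+ 2) * x * y
    aa ab bb : Vector ℤ n
    aa i = a i * a i
    ab i = a i * b i
    bb i = b i * b i
    square-expand : ∀ x y u v →
      (x * u + y * v) * (x * u + y * v) ≡ ((x * x) * (u * u) + ((+ 2) * x * y) * (u * v)) + (y * y) * (v * v)
    square-expand = solve-∀

  -- With A = ‖a‖², B = ‖b‖², P = ⟨a,b⟩:  0 ≤ ‖P a − A b‖² = A (A B − P²).
  cauchy-schwarz : ∀ {n} (a b : Vector ℤ n) → 0ℤ < ‖ a ‖² → ⟨ a , b ⟩ * ⟨ a , b ⟩ ≤ ‖ a ‖² * ‖ b ‖²
  cauchy-schwarz a b A>0 = 0≤i-j⇒j≤i (*-cancelˡ-≤-pos 0ℤ _ A {{ℤ.positive A>0}} A*[AB-P²]≥0)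
    where
    A B P : ℤ
    A = ‖ a ‖²
    B = ‖ b ‖²
    P = ⟨ a , b ⟩
    collect : ∀ A B P → (P * P) * A + ((+ 2) * P * (- A)) * P + ((- A) * (- A)) * B ≡ A * (A * B - P * P)
    collect = solve-∀
    A*[AB-P²]≥0 : A * 0ℤ ≤ A * (A * B - P * P)
    A*[AB-P²]≥0 = subst₂ _≤_ (sym (*-zeroʳ A)) (trans (‖‖²-expand P (- A) a b) (collect A B P))
                         (‖‖²-nonNeg (λ i → P * a i + (- A) * b i))

  prev : ∀ {n} → Fin (suc n) → Fin (suc n)
  prev zero    = fromℕ _
  prev (suc i) = inject₁ i

  module _ {n : ℕ} where

    sum-rotate : (g : Vector ℤ (suc n)) → sum (g ∘ prev) ≡ sum g
    sum-rotate g = trans (+-comm (g (fromℕ n)) _) (sym (sum-init-last g))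

    sum-telescope : (g : Vector ℤ (suc n)) → sum (λ i → g (prev i) - g i) ≡ 0ℤ
    sum-telescope g = begin
      sum (λ i → g (prev i) - g i)        ≡⟨ ∑-distrib-+ (g ∘ prev) (λ i → - g i) ⟩
      sum (g ∘ prev) + sum (λ i → - g i)  ≡⟨ cong₂ _+_ (sum-rotate g) (sum-neg g) ⟩
      sum g - sum g                       ≡⟨ +-inverseʳ (sum g) ⟩
      0ℤ                                  ∎
      where open ≡-Reasoning

    Δ : Vector ℤ (suc n) → Vector ℤ (suc n)
    Δ v i = v i - v (prev i)

    Δ-cong : ∀ {u v} → (∀ i → u i ≡ v i) → ∀ i → Δ u i ≡ Δ v i
    Δ-cong u≗v i = cong₂ _-_ (u≗v i) (u≗v (prev i))

    Δ-scale : ∀ c v i → Δ (λ j → c * v j) i ≡ c * Δ v i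
    Δ-scale c v i = sym (*-distribˡ-minus c (v i) (v (prev i)))
      where
      *-distribˡ-minus : ∀ c x y → c * (x - y) ≡ c * x - c * y
      *-distribˡ-minus = solve-∀

    summation-by-parts : ∀ v → ⟨ v ∘ prev , (λ i → - Δ (Δ v) i) ⟩ ≡ ‖ Δ v ‖²
    summation-by-parts v = begin
      ⟨ v ∘ prev , (λ i → - Δ (Δ v) i) ⟩
        ≡⟨ sum-cong-≗ (λ i → pointwise (v i) (v (prev i)) (v (prev (prev i)))) ⟩
      sum (λ i → (Δ v i * Δ v i + (sq (prev i) - sq i)) - (cross (prev i) - cross i))
        ≡⟨ ∑-distrib-+ (λ i → Δ v i * Δ v i + (sq (prev i) - sq i)) (λ i → - (cross (prev i) - cross i)) ⟩
      sum (λ i → Δ v i * Δ v i + (sq (prev i) - sq i)) + sum (λ i → - (cross (prev i) - cross i))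
        ≡⟨ cong₂ _+_ (∑-distrib-+ (λ i → Δ v i * Δ v i) (λ i → sq (prev i) - sq i))
                     (sum-neg (λ i → cross (prev i) - cross i)) ⟩
      (‖ Δ v ‖² + sum (λ i → sq (prev i) - sq i)) - sum (λ i → cross (prev i) - cross i)
        ≡⟨ cong₂ _-_ (cong (λ s → ‖ Δ v ‖² + s) (sum-telescope sq)) (sum-telescope cross) ⟩
      (‖ Δ v ‖² + 0ℤ) - 0ℤ
        ≡⟨ trans (+-identityʳ _) (+-identityʳ _) ⟩
      ‖ Δ v ‖² ∎
      where
      open ≡-Reasoning
      sq cross : Vector ℤ (suc n)
      sq i = v i * v i
      cross i = v i * v (prev i)
      pointwise : ∀ x y z →
        y * - ((x - y) - (y - z)) ≡ ((x - y) * (x - y) + (y * y - x * x)) - (y * z - x * y)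
      pointwise = solve-∀

    ‖Δ‖²-logConvex : ∀ v → 0ℤ < ‖ v ‖² → ‖ Δ v ‖² * ‖ Δ v ‖² ≤ ‖ v ‖² * ‖ Δ (Δ v) ‖²
    ‖Δ‖²-logConvex v v≠0 =
      subst₂ _≤_ (cong₂ _*_ (summation-by-parts v) (summation-by-parts v)) (cong₂ _*_ rotate negate)
        (cauchy-schwarz (v ∘ prev) (λ i → - Δ (Δ v) i) (subst (0ℤ <_) (sym rotate) v≠0))
      where
      rotate : ‖ v ∘ prev ‖² ≡ ‖ v ‖²
      rotate = sum-rotate (λ i → v i * v i)
      negate : ‖ (λ i → - Δ (Δ v) i) ‖² ≡ ‖ Δ (Δ v) ‖²
      negate = sum-cong-≗ (λ i → neg-square (Δ (Δ v) i))
        where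
        neg-square : ∀ x → (- x) * (- x) ≡ x * x
        neg-square = solve-∀

  LogConvex : (ℕ → ℤ) → Set
  LogConvex f = ∀ k → 0ℤ < f k → f (suc k) * f (suc k) ≤ f k * f (suc (suc k))

  module _ {f : ℕ → ℤ} (convex : LogConvex f) (p q : ℤ) .{{_ : Positive p}} .{{_ : NonNegative q}} where

    ratio-bound-step : ∀ {k} → 0ℤ < f k → p * f k ≤ q * f (suc k) →
                       0ℤ < f (suc k) × p * f (suc k) ≤ q * f (suc (suc k))
    ratio-bound-step {k} f₀>0 p*f₀≤q*f₁ =
      f₁>0 , *-cancelˡ-≤-pos _ _ f₀ {{ℤ.positive f₀>0}} f₀*p*f₁≤f₀*q*f₂
      where
      f₀ f₁ f₂ : ℤ
      f₀ = f k
      f₁ = f (suc k)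
      f₂ = f (suc (suc k))
      f₁>0 : 0ℤ < f₁
      f₁>0 = *-cancelˡ-<-nonNeg q (begin-strict
        q * 0ℤ   ≡⟨ *-zeroʳ q ⟩
        0ℤ       ≡⟨ *-zeroʳ p ⟨
        p * 0ℤ   <⟨ *-monoˡ-<-pos p f₀>0 ⟩
        p * f₀   ≤⟨ p*f₀≤q*f₁ ⟩
        q * f₁   ∎)
        where open ≤-Reasoning
      f₀*p*f₁≤f₀*q*f₂ : f₀ * (p * f₁) ≤ f₀ * (q * f₂)
      f₀*p*f₁≤f₀*q*f₂ = begin
        f₀ * (p * f₁)   ≡⟨ swap f₀ p f₁ ⟩
        (p * f₀) * f₁   ≤⟨ *-monoʳ-≤-nonNeg f₁ {{ℤ.nonNegative (<⇒≤ f₁>0)}} p*f₀≤q*f₁ ⟩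
        (q * f₁) * f₁   ≡⟨ *-assoc q f₁ f₁ ⟩
        q * (f₁ * f₁)   ≤⟨ *-monoˡ-≤-nonNeg q (convex k f₀>0) ⟩
        q * (f₀ * f₂)   ≡⟨ left-comm f₀ q f₂ ⟨
        f₀ * (q * f₂)   ∎
        where
        open ≤-Reasoning
        swap : ∀ x y z → x * (y * z) ≡ (y * x) * z
        swap = solve-∀
        left-comm : ∀ x y z → x * (y * z) ≡ y * (x * z)
        left-comm = solve-∀

    ratio-bound : ∀ {k} → 0ℤ < f k → p * f k ≤ q * f (suc k) →
                  ∀ t → 0ℤ < f (k ℕ.+ t) × p * f (k ℕ.+ t) ≤ q * f (suc (k ℕ.+ t))
    ratio-bound {k} f₀>0 p*f₀≤q*f₁ zero    rewrite ℕP.+-identityʳ k = f₀>0 , p*f₀≤q*f₁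
    ratio-bound {k} f₀>0 p*f₀≤q*f₁ (suc t) rewrite ℕP.+-suc k t =
      uncurry ratio-bound-step (ratio-bound f₀>0 p*f₀≤q*f₁ t)

  module _ {n : ℕ} where

    δ : Vector ℤ (suc n)
    δ zero    = 1ℤ
    δ (suc _) = 0ℤ

    -- the coefficients of (1 − x)^k modulo x^(n+1) − 1
    binomial : ℕ → Vector ℤ (suc n)
    binomial zero    = δ
    binomial (suc k) = Δ (binomial k)

    binomial-proportional : ∀ {k k′} c → (∀ i → binomial k i ≡ c * binomial k′ i) →
                            ∀ j i → binomial (j ℕ.+ k) i ≡ c * binomial (j ℕ.+ k′) i
    binomial-proportional         c prop zero    = prop
    binomial-proportional {k′ = k′} c prop (suc j) i =
      trans (Δ-cong (binomial-proportional c prop j) i) (Δ-scale c (binomial (j ℕ.+ k′)) i)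

    ‖binomial‖²-logConvex : LogConvex (λ k → ‖ binomial k ‖²)
    ‖binomial‖²-logConvex k = ‖Δ‖²-logConvex (binomial k)

  module _ (r : ℕ) where

    ‖binomial₁‖² : ‖ binomial {3 ℕ.+ r} 1 ‖² ≡ + 2
    ‖binomial₁‖² = cong (λ s → + 1 + (+ 1 + (+ 0 + (+ 0 + s)))) (sum-replicate-zero r)

    ‖binomial₂‖² : ‖ binomial {3 ℕ.+ r} 2 ‖² ≡ + 6
    ‖binomial₂‖² = cong (λ s → + 1 + (+ 4 + (+ 1 + (+ 0 + s)))) (sum-replicate-zero r)

    ‖binomial₃‖² : ‖ binomial {3 ℕ.+ r} 3 ‖² ≡ + 20
    ‖binomial₃‖² = cong (λ s → + 1 + (+ 9 + (+ 9 + (+ 1 + s)))) (sum-replicate-zero r)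

    binomial-not-proportional : ∀ M c → ¬ (∀ i → binomial {3 ℕ.+ r} (2 ℕ.+ M) i ≡ c * binomial 1 i)
    binomial-not-proportional M c prop = <⇒≱ 18Y<20Y 20Y≤18Y
      where
      Y : ℤ
      Y = c * c
      E : ℕ → ℤ
      E k = ‖ binomial {3 ℕ.+ r} k ‖²
      E-periodic : ∀ j → E (j ℕ.+ (2 ℕ.+ M)) ≡ Y * E (j ℕ.+ 1)
      E-periodic j = trans (‖‖²-cong (binomial-proportional c prop j)) (‖‖²-scale c (binomial (j ℕ.+ 1)))
      E[2+M]≡2Y : E (2 ℕ.+ M) ≡ Y * + 2
      E[2+M]≡2Y = trans (E-periodic 0) (cong (Y *_) ‖binomial₁‖²)
      E[3+M]≡6Y : E (3 ℕ.+ M) ≡ Y * + 6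
      E[3+M]≡6Y = trans (E-periodic 1) (cong (Y *_) ‖binomial₂‖²)
      bound : 0ℤ < E (2 ℕ.+ M) × + 10 * E (2 ℕ.+ M) ≤ + 3 * E (3 ℕ.+ M)
      bound = ratio-bound ‖binomial‖²-logConvex (+ 10) (+ 3) {k = 2}
                (subst (0ℤ <_) (sym ‖binomial₂‖²) (+<+ (ℕ.s≤s ℕ.z≤n)))
                (subst₂ (λ E₂ E₃ → + 10 * E₂ ≤ + 3 * E₃) (sym ‖binomial₂‖²) (sym ‖binomial₃‖²) ≤-refl)
                M
      20Y≤18Y : + 10 * (Y * + 2) ≤ + 3 * (Y * + 6)
      20Y≤18Y = subst₂ (λ E₂ E₃ → + 10 * E₂ ≤ + 3 * E₃) E[2+M]≡2Y E[3+M]≡6Y (proj₂ bound)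
      18Y<20Y : + 3 * (Y * + 6) < + 10 * (Y * + 2)
      18Y<20Y = subst₂ _<_ (+-identityʳ _) (18Y+2Y≡20Y Y)
                  (+-monoʳ-< (+ 3 * (Y * + 6)) (subst (0ℤ <_) E[2+M]≡2Y (proj₁ bound)))
        where
        18Y+2Y≡20Y : ∀ Y → + 3 * (Y * + 6) + Y * + 2 ≡ + 10 * (Y * + 2)
        18Y+2Y≡20Y = solve-∀

module Reduction {c ℓ} (F : CharZeroField c ℓ) where

  open import Data.Nat as ℕ using (ℕ; zero; suc; _≤_; s≤s)
  import Data.Nat.Properties as ℕP
  open import Data.Integer as ℤ using (ℤ; +_; -[1+_]; _⊖_)
  import Data.Integer.Properties as ℤP
  open import Data.Fin using (Fin; zero; suc; toℕ; fromℕ; inject₁)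
  open import Data.Fin.Properties using (toℕ-fromℕ; toℕ-inject₁; toℕ<n)
  open import Data.List using ([]; _∷_; length; replicate)
  open import Data.List.Properties using (length-replicate)
  open import Data.Product using (Σ; _,_)
  open import Data.Vec.Functional using (Vector)
  open import Function using (_∘_)
  import Relation.Binary.PropositionalEquality as P
  open import Relation.Nullary using (contradiction)
  open CharZeroField F hiding (zero)
  open Poly F
  open import Algebra.Properties.Ring ring using (-0#≈0#; -‿involutive; -‿+-comm; -1*x≈-x)
  open import Algebra.Properties.CommutativeSemigroup +-commutativeSemigroup using (interchange)
  open import Relation.Binary.Reasoning.Setoid setoid
  open CyclicVectors using (prev; binomial)

  [x+y]-[z+w] : ∀ x y z w → (x + y) - (z + w) ≈ (x - z) + (y - w)
  [x+y]-[z+w] x y z w = trans (+-congˡ (sym (-‿+-comm z w))) (interchange x y (- z) (- w))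

  [x+y]-[x+z] : ∀ x y z → (x + y) - (x + z) ≈ y - z
  [x+y]-[x+z] x y z = trans ([x+y]-[z+w] x y x z) (trans (+-congʳ (-‿inverseʳ x)) (+-identityˡ _))

  ofℕ : ℕ → Carrier
  ofℕ = ringFromℕ commRing

  ofℤ : ℤ → Carrier
  ofℤ (+ k)    = ofℕ k
  ofℤ -[1+ k ] = - ofℕ (suc k)

  ofℕ-+ : ∀ a b → ofℕ (a ℕ.+ b) ≈ ofℕ a + ofℕ b
  ofℕ-+ zero    b = sym (+-identityˡ _)
  ofℕ-+ (suc a) b = trans (+-congˡ (ofℕ-+ a b)) (sym (+-assoc _ _ _))

  ofℤ-⊖ : ∀ a b → ofℤ (a ⊖ b) ≈ ofℕ a - ofℕ b
  ofℤ-⊖ a       zero    = sym (trans (+-congˡ -0#≈0#) (+-identityʳ _))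
  ofℤ-⊖ zero    (suc b) = sym (+-identityˡ _)
  ofℤ-⊖ (suc a) (suc b) = begin
    ofℤ (suc a ⊖ suc b)         ≡⟨ P.cong ofℤ (ℤP.[1+m]⊖[1+n]≡m⊖n a b) ⟩
    ofℤ (a ⊖ b)                 ≈⟨ ofℤ-⊖ a b ⟩
    ofℕ a - ofℕ b               ≈⟨ [x+y]-[x+z] 1# (ofℕ a) (ofℕ b) ⟨
    ofℕ (suc a) - ofℕ (suc b)   ∎

  ofℤ-+ : ∀ a b → ofℤ (a ℤ.+ b) ≈ ofℤ a + ofℤ b
  ofℤ-+ (+ a)    (+ b)    = ofℕ-+ a b
  ofℤ-+ (+ a)    -[1+ b ] = ofℤ-⊖ a (suc b)
  ofℤ-+ -[1+ a ] (+ b)    = trans (ofℤ-⊖ b (suc a)) (+-comm _ _)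
  ofℤ-+ -[1+ a ] -[1+ b ] = begin
    - ofℕ (suc (suc (a ℕ.+ b)))     ≡⟨ P.cong (λ k → - ofℕ (suc k)) (ℕP.+-suc a b) ⟨
    - ofℕ (suc a ℕ.+ suc b)         ≈⟨ -‿cong (ofℕ-+ (suc a) (suc b)) ⟩
    - (ofℕ (suc a) + ofℕ (suc b))   ≈⟨ -‿+-comm _ _ ⟨
    - ofℕ (suc a) + - ofℕ (suc b)   ∎

  ofℤ-neg : ∀ a → ofℤ (ℤ.- a) ≈ - ofℤ a
  ofℤ-neg (+ zero)  = sym -0#≈0#
  ofℤ-neg (+ suc a) = refl
  ofℤ-neg -[1+ a ]  = sym (-‿involutive _)

  ofℤ-minus : ∀ a b → ofℤ (a ℤ.- b) ≈ ofℤ a - ofℤ b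
  ofℤ-minus a b = trans (ofℤ-+ a (ℤ.- b)) (+-congˡ (ofℤ-neg b))

  ofℤ≈0⇒≡0 : ∀ a → ofℤ a ≈ 0# → a P.≡ ℤ.0ℤ
  ofℤ≈0⇒≡0 (+ a)    ofℕ≈0  = P.cong +_ (charZero a ofℕ≈0)
  ofℤ≈0⇒≡0 -[1+ a ] -ofℕ≈0 =
    contradiction (charZero (suc a) (trans (sym (-‿involutive _)) (trans (-‿cong -ofℕ≈0) -0#≈0#))) ℕP.1+n≢0

  ofℤ-injective : ∀ a b → ofℤ a ≈ ofℤ b → a P.≡ b
  ofℤ-injective a b a≈b =
    ℤP.i-j≡0⇒i≡j a b (ofℤ≈0⇒≡0 _ (trans (ofℤ-minus a b) (trans (+-congʳ a≈b) (-‿inverseʳ _))))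

  coeff-beyond-length : ∀ p {k} → length p ≤ k → coeff p k P.≡ 0#
  coeff-beyond-length []      _           = P.refl
  coeff-beyond-length (a ∷ p) (s≤s |p|≤k) = coeff-beyond-length p |p|≤k

  coeff-replicate : ∀ {a} k {j} → j ℕ.< k → coeff (replicate k a) j P.≡ a
  coeff-replicate (suc k) {zero}  _         = P.refl
  coeff-replicate (suc k) {suc j} (s≤s j<k) = coeff-replicate k j<k

  -- The residue of p modulo x^(n+1) − 1, as its vector of coefficients indexed by exponents
  -- mod n+1; multiplication by x becomes the rotation prev.
  reduce : ∀ {n} → Pol → Vector Carrier (suc n)
  reduce     []      i       = 0#
  reduce {n} (a ∷ p) zero    = a + reduce {n} p (prev zero)
  reduce {n} (a ∷ p) (suc i) = reduce {n} p (prev (suc i))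

  module _ {n : ℕ} where

    reduce-shift : ∀ p (i : Fin (suc n)) → reduce (0# ∷ p) i ≈ reduce p (prev i)
    reduce-shift p zero    = +-identityˡ _
    reduce-shift p (suc i) = refl

    reduce-≈0 : ∀ p → (∀ k → coeff p k ≈ 0#) → (i : Fin (suc n)) → reduce p i ≈ 0#
    reduce-≈0 []      p≈0 i       = refl
    reduce-≈0 (a ∷ p) p≈0 zero    = trans (+-cong (p≈0 0) (reduce-≈0 p (p≈0 ∘ suc) _)) (+-identityˡ 0#)
    reduce-≈0 (a ∷ p) p≈0 (suc i) = reduce-≈0 p (p≈0 ∘ suc) _

    reduce-cong : ∀ p r → p ≈P r → (i : Fin (suc n)) → reduce p i ≈ reduce r i
    reduce-cong []      []      p≈r i       = refl
    reduce-cong []      (b ∷ r) p≈r i       = sym (reduce-≈0 (b ∷ r) (sym ∘ p≈r) i)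
    reduce-cong (a ∷ p) []      p≈r i       = reduce-≈0 (a ∷ p) p≈r i
    reduce-cong (a ∷ p) (b ∷ r) p≈r zero    = +-cong (p≈r 0) (reduce-cong p r (p≈r ∘ suc) _)
    reduce-cong (a ∷ p) (b ∷ r) p≈r (suc i) = reduce-cong p r (p≈r ∘ suc) _

    reduce-+P : ∀ p r (i : Fin (suc n)) → reduce (p +P r) i ≈ reduce p i + reduce r i
    reduce-+P []      r       i       = sym (+-identityˡ _)
    reduce-+P (a ∷ p) []      i       = sym (+-identityʳ _)
    reduce-+P (a ∷ p) (b ∷ r) zero    = trans (+-congˡ (reduce-+P p r _)) (interchange a b _ _)
    reduce-+P (a ∷ p) (b ∷ r) (suc i) = reduce-+P p r _

    reduce-·P : ∀ a p (i : Fin (suc n)) → reduce (a ·P p) i ≈ a * reduce p i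
    reduce-·P a []      i       = sym (zeroʳ a)
    reduce-·P a (b ∷ p) zero    = trans (+-congˡ (reduce-·P a p _)) (sym (distribˡ a b _))
    reduce-·P a (b ∷ p) (suc i) = reduce-·P a p _

    reduce-oneMinusX*P : ∀ p (i : Fin (suc n)) → reduce (oneMinusX *P p) i ≈ reduce p i - reduce p (prev i)
    reduce-oneMinusX*P p i = begin
      reduce ((1# ·P p) +P (0# ∷ ((- 1# ·P p) +P (0# ∷ [])))) i
        ≈⟨ reduce-+P (1# ·P p) _ i ⟩
      reduce (1# ·P p) i + reduce (0# ∷ ((- 1# ·P p) +P (0# ∷ []))) i
        ≈⟨ +-cong (trans (reduce-·P 1# p i) (*-identityˡ _)) (reduce-shift _ i) ⟩
      reduce p i + reduce ((- 1# ·P p) +P (0# ∷ [])) (prev i)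
        ≈⟨ +-congˡ (reduce-+P (- 1# ·P p) (0# ∷ []) (prev i)) ⟩
      reduce p i + (reduce (- 1# ·P p) (prev i) + reduce (0# ∷ []) (prev i))
        ≈⟨ +-congˡ (+-cong (reduce-·P (- 1#) p (prev i)) (reduce-shift [] (prev i))) ⟩
      reduce p i + (- 1# * reduce p (prev i) + 0#)
        ≈⟨ +-congˡ (trans (+-identityʳ _) (-1*x≈-x _)) ⟩
      reduce p i - reduce p (prev i) ∎

    reduce-binomial : ∀ k (i : Fin (suc n)) → reduce (oneMinusX ^P k) i ≈ ofℤ (binomial k i)
    reduce-binomial zero    zero    = refl
    reduce-binomial zero    (suc i) = refl
    reduce-binomial (suc k) i       = begin
      reduce (oneMinusX *P (oneMinusX ^P k)) i
        ≈⟨ reduce-oneMinusX*P (oneMinusX ^P k) i ⟩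
      reduce (oneMinusX ^P k) i - reduce (oneMinusX ^P k) (prev i)
        ≈⟨ +-cong (reduce-binomial k i) (-‿cong (reduce-binomial k (prev i))) ⟩
      ofℤ (binomial k i) - ofℤ (binomial k (prev i))
        ≈⟨ ofℤ-minus (binomial k i) (binomial k (prev i)) ⟨
      ofℤ (binomial (suc k) i) ∎

    reduce-coeff : ∀ p → length p ≤ suc n → (i : Fin (suc n)) → reduce p i ≈ coeff p (toℕ i)
    reduce-coeff []      _           i       = refl
    reduce-coeff (a ∷ p) (s≤s |p|≤n) zero    = begin
      a + reduce p (fromℕ n)        ≈⟨ +-congˡ (reduce-coeff p (ℕP.m≤n⇒m≤1+n |p|≤n) (fromℕ n)) ⟩
      a + coeff p (toℕ (fromℕ n))   ≡⟨ P.cong (λ k → a + coeff p k) (toℕ-fromℕ n) ⟩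
      a + coeff p n                 ≡⟨ P.cong (λ x → a + x) (coeff-beyond-length p |p|≤n) ⟩
      a + 0#                        ≈⟨ +-identityʳ a ⟩
      a                             ∎
    reduce-coeff (a ∷ p) (s≤s |p|≤n) (suc i) =
      trans (reduce-coeff p (ℕP.m≤n⇒m≤1+n |p|≤n) (inject₁ i)) (reflexive (P.cong (coeff p) (toℕ-inject₁ i)))

    reduce-geomSum : (i : Fin (suc n)) → reduce (geomSum (suc n)) i ≈ 1#
    reduce-geomSum i = trans (reduce-coeff (geomSum (suc n)) (ℕP.≤-reflexive (length-replicate (suc n))) i)
                             (reflexive (coeff-replicate (suc n) (toℕ<n i)))

    reduce-cons-*P-geomSum : ∀ a Q (i : Fin (suc n)) →
      reduce ((a ∷ Q) *P geomSum (suc n)) i ≈ a + reduce (Q *P geomSum (suc n)) (prev i)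
    reduce-cons-*P-geomSum a Q i = begin
      reduce ((a ·P G) +P (0# ∷ (Q *P G))) i         ≈⟨ reduce-+P (a ·P G) (0# ∷ (Q *P G)) i ⟩
      reduce (a ·P G) i + reduce (0# ∷ (Q *P G)) i   ≈⟨ +-cong (reduce-·P a G i) (reduce-shift (Q *P G) i) ⟩
      a * reduce G i + reduce (Q *P G) (prev i)      ≈⟨ +-congʳ (trans (*-congˡ (reduce-geomSum i)) (*-identityʳ a)) ⟩
      a + reduce (Q *P G) (prev i)                   ∎
      where
      G : Pol
      G = geomSum (suc n)

    reduce-*P-geomSum-rotate : ∀ Q (i : Fin (suc n)) →
      reduce (Q *P geomSum (suc n)) i ≈ reduce (Q *P geomSum (suc n)) (prev i)
    reduce-*P-geomSum-rotate []      i = refl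
    reduce-*P-geomSum-rotate (a ∷ Q) i = begin
      reduce ((a ∷ Q) *P geomSum (suc n)) i               ≈⟨ reduce-cons-*P-geomSum a Q i ⟩
      a + reduce (Q *P geomSum (suc n)) (prev i)          ≈⟨ +-congˡ (reduce-*P-geomSum-rotate Q (prev i)) ⟩
      a + reduce (Q *P geomSum (suc n)) (prev (prev i))   ≈⟨ reduce-cons-*P-geomSum a Q (prev i) ⟨
      reduce ((a ∷ Q) *P geomSum (suc n)) (prev i)        ∎

    ofℤ-binomial-from-identity : ∀ {m C Q} → (oneMinusX ^P m) ≈P (const C +P Q *P geomSum (suc n)) →
      (i : Fin (suc n)) → ofℤ (binomial (suc m) i) ≈ reduce (const C) i - reduce (const C) (prev i)
    ofℤ-binomial-from-identity {m} {C} {Q} identity i = begin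
      ofℤ (binomial (suc m) i)
        ≈⟨ reduce-binomial (suc m) i ⟨
      reduce (oneMinusX *P (oneMinusX ^P m)) i
        ≈⟨ reduce-oneMinusX*P (oneMinusX ^P m) i ⟩
      reduce (oneMinusX ^P m) i - reduce (oneMinusX ^P m) (prev i)
        ≈⟨ +-cong (reduce-cong (oneMinusX ^P m) (const C +P QG) identity i)
                  (-‿cong (reduce-cong (oneMinusX ^P m) (const C +P QG) identity (prev i))) ⟩
      reduce (const C +P QG) i - reduce (const C +P QG) (prev i)
        ≈⟨ +-cong (reduce-+P (const C) QG i) (-‿cong (reduce-+P (const C) QG (prev i))) ⟩
      (reduce (const C) i + reduce QG i) - (reduce (const C) (prev i) + reduce QG (prev i))
        ≈⟨ [x+y]-[z+w] _ _ _ _ ⟩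
      (reduce (const C) i - reduce (const C) (prev i)) + (reduce QG i - reduce QG (prev i))
        ≈⟨ +-congˡ (trans (+-congʳ (reduce-*P-geomSum-rotate Q i)) (-‿inverseʳ _)) ⟩
      (reduce (const C) i - reduce (const C) (prev i)) + 0#
        ≈⟨ +-identityʳ _ ⟩
      reduce (const C) i - reduce (const C) (prev i) ∎
      where
      QG : Pol
      QG = Q *P geomSum (suc n)

  binomial-multiple-from-identity : ∀ {n m C Q} → (oneMinusX ^P m) ≈P (const C +P Q *P geomSum (2 ℕ.+ n)) →
    Σ ℤ λ k → ∀ i → binomial {suc n} (suc m) i P.≡ k ℤ.* binomial 1 i
  binomial-multiple-from-identity {n} {m} {C} {Q} identity = k , proportional
    where
    b : Vector ℤ (2 ℕ.+ n)
    b = binomial (suc m)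
    k : ℤ
    k = b zero
    Δreduce : ∀ i → ofℤ (b i) ≈ reduce (const C) i - reduce (const C) (prev i)
    Δreduce = ofℤ-binomial-from-identity {m = m} {Q = Q} identity
    ofℤk≈C : ofℤ k ≈ C
    ofℤk≈C = trans (Δreduce zero) (trans (+-congˡ -0#≈0#) (trans (+-identityʳ _) (+-identityʳ C)))
    proportional : ∀ i → b i P.≡ k ℤ.* binomial 1 i
    proportional zero          = P.sym (ℤP.*-identityʳ k)
    proportional (suc zero)    = P.trans (ofℤ-injective _ _ (begin
      ofℤ (b (suc zero))   ≈⟨ Δreduce (suc zero) ⟩
      0# - (C + 0#)        ≈⟨ +-identityˡ _ ⟩
      - (C + 0#)           ≈⟨ -‿cong (trans (+-identityʳ C) (sym ofℤk≈C)) ⟩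
      - ofℤ k              ≈⟨ ofℤ-neg k ⟨
      ofℤ (ℤ.- k)          ∎))
      (P.trans (P.sym (ℤP.-1*i≡-i k)) (ℤP.*-comm ℤ.-1ℤ k))
    proportional (suc (suc j)) =
      P.trans (ofℤ≈0⇒≡0 _ (trans (Δreduce (suc (suc j))) (-‿inverseʳ 0#))) (P.sym (ℤP.*-zeroʳ k))

open import Data.Nat using (ℕ; _<_; _+_; suc; z≤n; s≤s)
open import Data.Product using (_,_)
open import Relation.Nullary using (¬_)

lemma14 : ∀ {c ℓ} (F : CharZeroField c ℓ) → let open Poly F in
    (q : ℕ) → 3 < q → (m : ℕ) → 0 < m → (C : CharZeroField.Carrier F) → (Q : Pol) →
    ¬ ((oneMinusX ^P m) ≈P (const C +P Q *P geomSum q))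
lemma14 F (suc (suc (suc (suc r)))) (s≤s (s≤s (s≤s (s≤s _)))) (suc m) (s≤s z≤n) C Q identity =
  let k , proportional = Reduction.binomial-multiple-from-identity F {n = 2 + r} {m = suc m} {C = C} {Q = Q} identity
  in CyclicVectors.binomial-not-proportional r m k proportional
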